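{- Let $A$ be a Heffter array $H(n;k)$ in which every row and every column sums (as integers) to $2nk+1$. Suppose there exist two sets of cells $H_1$ and $H_2$, each forming a Hamilton cycle, which are disjoint from each other and from the filled cells of $A$. Then there exists a Heffter array $H(n;k+4)$ in which every row and every column sums to $2n(k+4)+1$, and whose set of filled cells is precisely the union of the filled cells of $A$, $H_1$ and $H_2$.
   Context: A Heffter array $H(n;k)$ is an $n\times n$ array, some of whose cells are filled with integers, such that: each row and each column contains exactly $k$ filled cells; every row sum and column sum is congruent to $0$ modulo $2nk+1$; and for each integer $1\leq x\leq nk$, either $x$ or $-x$ appears in the array. Identify the cells of an $n\times n$ array with the edges of $K_{n,n}$ (cell $(i,j)$ corresponds to edge $\{a_i,b_j\}$); a set of cells forms a Hamilton cycle if the corresponding edges form a single cycle of length $2n$. -}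

module Defs where

open import Data.Nat as ℕ using (ℕ; zero; suc; _≤_)
open import Data.Fin using (Fin; toℕ) renaming (zero to fzero; suc to fsuc)
open import Data.Integer as ℤ using (ℤ; +_; -_)
open import Data.Integer.Divisibility using (_∣_)
open import Data.Maybe using (Maybe; just; nothing)
open import Data.Bool using (Bool; true; false)
open import Data.Product using (Σ; ∃; _×_; _,_)
open import Data.Sum using (_⊎_)
open import Function.Definitions using (Injective)
open import Relation.Binary.PropositionalEquality using (_≡_)

-- A partially filled n×n array of integers: `nothing` = empty cell.
Array : ℕ → Set
Array n = Fin n → Fin n → Maybe ℤ

-- A set of cells of an n×n array (cell (i,j) ↔ edge {a_i , b_j} of K_{n,n}).
CellSet : ℕ → Set
CellSet n = Fin n → Fin n → Bool

∑ℕ : ∀ {n} → (Fin n → ℕ) → ℕ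
∑ℕ {zero} f = 0
∑ℕ {suc n} f = f fzero ℕ.+ ∑ℕ (λ i → f (fsuc i))

∑ℤ : ∀ {n} → (Fin n → ℤ) → ℤ
∑ℤ {zero} f = + 0
∑ℤ {suc n} f = f fzero ℤ.+ ∑ℤ (λ i → f (fsuc i))

filled? : Maybe ℤ → ℕ
filled? (just _) = 1
filled? nothing = 0

val : Maybe ℤ → ℤ
val (just x) = x
val nothing = + 0

Filled : Maybe ℤ → Set
Filled c = ∃ λ x → c ≡ just x

rowCount colCount : ∀ {n} → Array n → Fin n → ℕ
rowCount A i = ∑ℕ (λ j → filled? (A i j))
colCount A j = ∑ℕ (λ i → filled? (A i j))

rowSum colSum : ∀ {n} → Array n → Fin n → ℤ
rowSum A i = ∑ℤ (λ j → val (A i j))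
colSum A j = ∑ℤ (λ i → val (A i j))

record IsHeffter (n k : ℕ) (A : Array n) : Set where
  field
    rowCnt : ∀ i → rowCount A i ≡ k
    colCnt : ∀ j → colCount A j ≡ k
    rowMod : ∀ i → + (2 ℕ.* n ℕ.* k ℕ.+ 1) ∣ rowSum A i
    colMod : ∀ j → + (2 ℕ.* n ℕ.* k ℕ.+ 1) ∣ colSum A j
    cover  : ∀ (x : ℕ) → 1 ≤ x → x ≤ n ℕ.* k →
             ∃ λ i → ∃ λ j → (A i j ≡ just (+ x)) ⊎ (A i j ≡ just (- (+ x)))

SumsTo : (n : ℕ) → Array n → ℤ → Set
SumsTo n A s = (∀ i → rowSum A i ≡ s) × (∀ j → colSum A j ≡ s)

CycNext : ∀ {n} → Fin n → Fin n → Set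
CycNext {n} t t' = (toℕ t' ≡ suc (toℕ t)) ⊎ ((suc (toℕ t) ≡ n) × (toℕ t' ≡ 0))

-- H is a Hamilton cycle of K_{n,n}: its edges form the single cycle
-- a_{σ 0} b_{τ 0} a_{σ 1} b_{τ 1} … a_{σ (n-1)} b_{τ (n-1)} a_{σ 0}
-- of length 2n, visiting all vertices (σ, τ injective, hence bijective).
-- A cycle of length 2n in a simple graph needs 2n ≥ 4, i.e. n ≥ 2.
IsHamiltonCycle : (n : ℕ) → CellSet n → Set
IsHamiltonCycle n H =
  2 ≤ n ×
  Σ (Fin n → Fin n) λ σ → Σ (Fin n → Fin n) λ τ →
    Injective _≡_ _≡_ σ × Injective _≡_ _≡_ τ ×
    (∀ i j → H i j ≡ true →
       ∃ λ t → (i ≡ σ t × j ≡ τ t) ⊎ (∃ λ t' → CycNext t t' × i ≡ σ t' × j ≡ τ t)) ×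
    (∀ t → H (σ t) (τ t) ≡ true) ×
    (∀ t t' → CycNext t t' → H (σ t') (τ t) ≡ true)

-- Take B = (−A) ∪ L, where L labels the 4n cells of H₁ ∪ H₂ with the new values nk+1, …, nk+4n.
-- Negating A makes each of its line sums −(2nk+1), so it suffices that every line of L has four
-- cells summing to (2nk+1) + (2n(k+4)+1).  Enumerate a Hamilton cycle as a_{σ 0} b_{τ 0} a_{σ 1} …
-- and label the edge a_{σ t} b_{τ t} by α t and the edge b_{τ t} a_{σ (t+1)} by β t; then column
-- τ t carries α t + β t and row σ t carries α t + β (t−1).  Cycle 1 gets α t = nk+1+t and
-- β t = nk+3n−t, cycle 2 gets α t = nk+2n−t and β t = nk+3n+1+t.  All column sums are then
-- constant, and so are the row sums, except in the row where a cycle closes (t = 0), where cycle 1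
-- loses n and cycle 2 gains n.  Counting the positions of both cycles from the same row makes the
-- two exceptions fall into one row, where they cancel.
module Submission where

open import Defs
open import Algebra.Bundles using (CommutativeMonoid)
open import Data.Bool using (true; false)
open import Data.Empty using (⊥-elim)
open import Data.Fin using (Fin; toℕ; opposite; punchOut; fromℕ<; combine; remQuot)
  renaming (zero to fzero; suc to fsuc)
open import Data.Fin.Patterns using (0F; 1F; 2F; 3F)
open import Data.Fin.Properties
  using (suc-injective; toℕ-injective; toℕ-fromℕ<; toℕ<n; _≟_; any?; injective⇒≤; punchOut-injective;
         opposite-prop; opposite-involutive; toℕ-combine; combine-remQuot)
open import Data.Integer as ℤ using (ℤ; +_; -_)
open import Data.Integer.Divisibility using (_∣_)
import Data.Integer.Properties as ℤ
import Data.Integer.Tactic.RingSolver as ℤ-Solver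
open import Data.List using (_∷_; [])
open import Data.Maybe using (Maybe; just; nothing; map; _<∣>_)
open import Data.Nat as ℕ using (ℕ; zero; suc; _+_; _*_; _∸_; _≤_; _<_; NonZero)
open import Data.Nat.DivMod
  using (_%_; _mod_; m%n<n; %-distribˡ-+; m%n%n≡m%n; m<n⇒m%n≡m; n%n≡0; [m+n]%n≡m%n)
import Data.Nat.Divisibility as ℕ
import Data.Nat.Properties as ℕ
open import Data.Nat.Tactic.RingSolver using (solve; solve-∀)
open import Data.Product using (Σ; ∃; _×_; _,_; proj₁; proj₂)
open import Data.Sum as Sum using (_⊎_; inj₁; inj₂; [_,_]′)
open import Function using (_∘_)
open import Function.Definitions using (Injective)
open import Relation.Binary.PropositionalEquality
  using (_≡_; _≢_; _≗_; refl; sym; trans; cong; cong₂; subst; subst₂; module ≡-Reasoning)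
open import Relation.Nullary using (yes; no)

-- Finite sums

module FinSum {c ℓ} (M : CommutativeMonoid c ℓ) where
  open CommutativeMonoid M
    using (Carrier; _≈_; _∙_; ε; ∙-cong; ∙-congˡ; identityˡ; identityʳ; comm; setoid)
  open import Algebra.Properties.CommutativeMonoid.Sum M public
    using (sum; sum-cong-≗; sum-cong-≋; sum-replicate-zero; ∑-distrib-+)
  open import Relation.Binary.Reasoning.Setoid setoid

  sum-vanishing : ∀ {n} (f : Fin n → Carrier) → (∀ j → f j ≈ ε) → sum f ≈ ε
  sum-vanishing {n} f f≈ε = begin
    sum f               ≈⟨ sum-cong-≋ f≈ε ⟩
    sum {n} (λ _ → ε)   ≈⟨ sum-replicate-zero n ⟩
    ε                   ∎

  sum-single : ∀ {n} (f : Fin n → Carrier) p → (∀ j → j ≢ p → f j ≈ ε) → sum f ≈ f p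
  sum-single f fzero f≈ε = begin
    f fzero ∙ sum (f ∘ fsuc)  ≈⟨ ∙-congˡ (sum-vanishing (f ∘ fsuc) (λ j → f≈ε (fsuc j) λ ())) ⟩
    f fzero ∙ ε               ≈⟨ identityʳ _ ⟩
    f fzero                   ∎
  sum-single f (fsuc p) f≈ε = begin
    f fzero ∙ sum (f ∘ fsuc)  ≈⟨ ∙-cong (f≈ε fzero λ ()) (sum-single (f ∘ fsuc) p
                                          (λ j j≢p → f≈ε (fsuc j) (j≢p ∘ suc-injective))) ⟩
    ε ∙ f (fsuc p)            ≈⟨ identityˡ _ ⟩
    f (fsuc p)                ∎

  sum-pair : ∀ {n} (f : Fin n → Carrier) p q → p ≢ q → (∀ j → j ≢ p → j ≢ q → f j ≈ ε) →
             sum f ≈ f p ∙ f q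
  sum-pair f fzero    fzero    p≢q f≈ε = ⊥-elim (p≢q refl)
  sum-pair f fzero    (fsuc q) p≢q f≈ε =
    ∙-congˡ (sum-single (f ∘ fsuc) q (λ j j≢q → f≈ε (fsuc j) (λ ()) (j≢q ∘ suc-injective)))
  sum-pair f (fsuc p) fzero    p≢q f≈ε = begin
    f fzero ∙ sum (f ∘ fsuc)  ≈⟨ ∙-congˡ (sum-single (f ∘ fsuc) p
                                          (λ j j≢p → f≈ε (fsuc j) (j≢p ∘ suc-injective) (λ ()))) ⟩
    f fzero ∙ f (fsuc p)      ≈⟨ comm _ _ ⟩
    f (fsuc p) ∙ f fzero      ∎
  sum-pair f (fsuc p) (fsuc q) p≢q f≈ε = begin
    f fzero ∙ sum (f ∘ fsuc)       ≈⟨ ∙-cong (f≈ε fzero (λ ()) (λ ())) (sum-pair (f ∘ fsuc) p q (p≢q ∘ cong fsuc)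
                                          (λ j j≢p j≢q → f≈ε (fsuc j) (j≢p ∘ suc-injective) (j≢q ∘ suc-injective))) ⟩
    ε ∙ (f (fsuc p) ∙ f (fsuc q))  ≈⟨ identityˡ _ ⟩
    f (fsuc p) ∙ f (fsuc q)        ∎

module ℕΣ = FinSum ℕ.+-0-commutativeMonoid
module ℤΣ = FinSum ℤ.+-0-commutativeMonoid

∑ℕ≡sum : ∀ {n} (f : Fin n → ℕ) → ∑ℕ f ≡ ℕΣ.sum f
∑ℕ≡sum {zero}  f = refl
∑ℕ≡sum {suc n} f = cong (λ s → f fzero + s) (∑ℕ≡sum (f ∘ fsuc))

∑ℤ≡sum : ∀ {n} (f : Fin n → ℤ) → ∑ℤ f ≡ ℤΣ.sum f
∑ℤ≡sum {zero}  f = refl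
∑ℤ≡sum {suc n} f = cong (λ s → f fzero ℤ.+ s) (∑ℤ≡sum (f ∘ fsuc))

∑ℕ-cong : ∀ {n} {f g : Fin n → ℕ} → f ≗ g → ∑ℕ f ≡ ∑ℕ g
∑ℕ-cong {f = f} {g} f≗g = trans (∑ℕ≡sum f) (trans (ℕΣ.sum-cong-≗ f≗g) (sym (∑ℕ≡sum g)))

∑ℤ-cong : ∀ {n} {f g : Fin n → ℤ} → f ≗ g → ∑ℤ f ≡ ∑ℤ g
∑ℤ-cong {f = f} {g} f≗g = trans (∑ℤ≡sum f) (trans (ℤΣ.sum-cong-≗ f≗g) (sym (∑ℤ≡sum g)))

∑ℕ-distrib-+ : ∀ {n} (f g : Fin n → ℕ) → ∑ℕ (λ j → f j + g j) ≡ ∑ℕ f + ∑ℕ g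
∑ℕ-distrib-+ f g = trans (∑ℕ≡sum (λ j → f j + g j))
  (trans (ℕΣ.∑-distrib-+ f g) (sym (cong₂ _+_ (∑ℕ≡sum f) (∑ℕ≡sum g))))

∑ℤ-distrib-+ : ∀ {n} (f g : Fin n → ℤ) → ∑ℤ (λ j → f j ℤ.+ g j) ≡ ∑ℤ f ℤ.+ ∑ℤ g
∑ℤ-distrib-+ f g = trans (∑ℤ≡sum (λ j → f j ℤ.+ g j))
  (trans (ℤΣ.∑-distrib-+ f g) (sym (cong₂ ℤ._+_ (∑ℤ≡sum f) (∑ℤ≡sum g))))

∑ℤ-neg : ∀ {n} (f : Fin n → ℤ) → ∑ℤ (λ j → - f j) ≡ - ∑ℤ f
∑ℤ-neg {zero}  f = refl
∑ℤ-neg {suc n} f =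
  trans (cong (λ s → - f fzero ℤ.+ s) (∑ℤ-neg (f ∘ fsuc))) (sym (ℤ.neg-distrib-+ (f fzero) _))

-- Partial arrays

val-<∣> : ∀ c d → (Filled c → d ≡ nothing) → val (c <∣> d) ≡ val c ℤ.+ val d
val-<∣> (just x) d disjoint rewrite disjoint (x , refl) = sym (ℤ.+-identityʳ x)
val-<∣> nothing  d disjoint = sym (ℤ.+-identityˡ (val d))

filled?-<∣> : ∀ c d → (Filled c → d ≡ nothing) → filled? (c <∣> d) ≡ filled? c + filled? d
filled?-<∣> (just x) d disjoint rewrite disjoint (x , refl) = refl
filled?-<∣> nothing  d disjoint = refl

Filled-<∣>⁻ : ∀ c d → Filled (c <∣> d) → Filled c ⊎ Filled d
Filled-<∣>⁻ (just x) d _      = inj₁ (x , refl)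
Filled-<∣>⁻ nothing  d filled = inj₂ filled

Filled-<∣>⁺ : ∀ c d → Filled c ⊎ Filled d → Filled (c <∣> d)
Filled-<∣>⁺ (just x) d _               = x , refl
Filled-<∣>⁺ nothing  d (inj₁ (_ , ()))
Filled-<∣>⁺ nothing  d (inj₂ filled)   = filled

val-map-neg : ∀ c → val (map -_ c) ≡ - val c
val-map-neg (just x) = refl
val-map-neg nothing  = refl

filled?-map : ∀ (f : ℤ → ℤ) c → filled? (map f c) ≡ filled? c
filled?-map f (just x) = refl
filled?-map f nothing  = refl

Filled-map⁻ : ∀ (f : ℤ → ℤ) c → Filled (map f c) → Filled c
Filled-map⁻ f (just x) _ = x , refl

module _ {n : ℕ} where

  _∪_ : Array n → Array n → Array n
  (M ∪ M') i j = M i j <∣> M' i j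

  negate : Array n → Array n
  negate M i j = map -_ (M i j)

  Disjoint : Array n → Array n → Set
  Disjoint M M' = ∀ i j → Filled (M i j) → M' i j ≡ nothing

  ∑val-<∣> : (c d : Fin n → Maybe ℤ) → (∀ j → Filled (c j) → d j ≡ nothing) →
             ∑ℤ (λ j → val (c j <∣> d j)) ≡ ∑ℤ (val ∘ c) ℤ.+ ∑ℤ (val ∘ d)
  ∑val-<∣> c d disjoint =
    trans (∑ℤ-cong λ j → val-<∣> (c j) (d j) (disjoint j)) (∑ℤ-distrib-+ (val ∘ c) (val ∘ d))

  ∑filled?-<∣> : (c d : Fin n → Maybe ℤ) → (∀ j → Filled (c j) → d j ≡ nothing) →
                 ∑ℕ (λ j → filled? (c j <∣> d j)) ≡ ∑ℕ (filled? ∘ c) + ∑ℕ (filled? ∘ d)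
  ∑filled?-<∣> c d disjoint =
    trans (∑ℕ-cong λ j → filled?-<∣> (c j) (d j) (disjoint j))
          (∑ℕ-distrib-+ (filled? ∘ c) (filled? ∘ d))

  ∑val-negate : (c : Fin n → Maybe ℤ) → ∑ℤ (λ j → val (map -_ (c j))) ≡ - ∑ℤ (val ∘ c)
  ∑val-negate c = trans (∑ℤ-cong (val-map-neg ∘ c)) (∑ℤ-neg (val ∘ c))

  ∑filled?-negate : (c : Fin n → Maybe ℤ) → ∑ℕ (λ j → filled? (map -_ (c j))) ≡ ∑ℕ (filled? ∘ c)
  ∑filled?-negate c = ∑ℕ-cong (filled?-map -_ ∘ c)

  ∑-two-cells : (c : Fin n → Maybe ℤ) {p q : Fin n} {x y : ℤ} →
                p ≢ q → c p ≡ just x → c q ≡ just y → (∀ j → j ≢ p → j ≢ q → c j ≡ nothing) →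
                ∑ℤ (val ∘ c) ≡ x ℤ.+ y × ∑ℕ (filled? ∘ c) ≡ 2
  ∑-two-cells c {p} {q} p≢q cp cq elsewhere =
    trans (∑ℤ≡sum (val ∘ c))
      (trans (ℤΣ.sum-pair (val ∘ c) p q p≢q (λ j j≢p j≢q → cong val (elsewhere j j≢p j≢q)))
             (cong₂ ℤ._+_ (cong val cp) (cong val cq))) ,
    trans (∑ℕ≡sum (filled? ∘ c))
      (trans (ℕΣ.sum-pair (filled? ∘ c) p q p≢q (λ j j≢p j≢q → cong filled? (elsewhere j j≢p j≢q)))
             (cong₂ _+_ (cong filled? cp) (cong filled? cq)))

LineCounts : (n : ℕ) → Array n → ℕ → Set
LineCounts n M k = (∀ i → rowCount M i ≡ k) × (∀ j → colCount M j ≡ k)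

module _ {n : ℕ} {M M' : Array n} (disjoint : Disjoint M M') where

  rowSum-∪ : ∀ i → rowSum (M ∪ M') i ≡ rowSum M i ℤ.+ rowSum M' i
  rowSum-∪ i = ∑val-<∣> (M i) (M' i) (disjoint i)

  colSum-∪ : ∀ j → colSum (M ∪ M') j ≡ colSum M j ℤ.+ colSum M' j
  colSum-∪ j = ∑val-<∣> (λ i → M i j) (λ i → M' i j) (λ i → disjoint i j)

  SumsTo-∪ : ∀ {s s'} → SumsTo n M s → SumsTo n M' s' → SumsTo n (M ∪ M') (s ℤ.+ s')
  SumsTo-∪ (rows , cols) (rows' , cols') =
    (λ i → trans (rowSum-∪ i) (cong₂ ℤ._+_ (rows i) (rows' i))) ,
    (λ j → trans (colSum-∪ j) (cong₂ ℤ._+_ (cols j) (cols' j)))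

  LineCounts-∪ : ∀ {k k'} → LineCounts n M k → LineCounts n M' k' → LineCounts n (M ∪ M') (k + k')
  LineCounts-∪ (rows , cols) (rows' , cols') =
    (λ i → trans (∑filled?-<∣> (M i) (M' i) (disjoint i)) (cong₂ _+_ (rows i) (rows' i))) ,
    (λ j → trans (∑filled?-<∣> (λ i → M i j) (λ i → M' i j) (λ i → disjoint i j))
                 (cong₂ _+_ (cols j) (cols' j)))

module _ {n : ℕ} {M : Array n} where

  SumsTo-negate : ∀ {s} → SumsTo n M s → SumsTo n (negate M) (- s)
  SumsTo-negate (rows , cols) =
    (λ i → trans (∑val-negate (M i)) (cong -_ (rows i))) ,
    (λ j → trans (∑val-negate (λ i → M i j)) (cong -_ (cols j)))

  LineCounts-negate : ∀ {k} → LineCounts n M k → LineCounts n (negate M) k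
  LineCounts-negate (rows , cols) =
    (λ i → trans (∑filled?-negate (M i)) (rows i)) ,
    (λ j → trans (∑filled?-negate (λ i → M i j)) (cols j))

  SumsTo⇒divisible : ∀ {s} → SumsTo n M (+ s) → (∀ i → + s ∣ rowSum M i) × (∀ j → + s ∣ colSum M j)
  SumsTo⇒divisible {s} (rows , cols) =
    (λ i → subst (+ s ∣_) (sym (rows i)) ℕ.∣-refl) , (λ j → subst (+ s ∣_) (sym (cols j)) ℕ.∣-refl)

negate-∪-support⁻ : ∀ {n} (A L : Array n) i j →
                    Filled ((negate A ∪ L) i j) → Filled (A i j) ⊎ Filled (L i j)
negate-∪-support⁻ A L i j =
  Sum.map₁ (Filled-map⁻ -_ (A i j)) ∘ Filled-<∣>⁻ (map -_ (A i j)) (L i j)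

negate-∪-support⁺ : ∀ {n} (A L : Array n) i j →
                    Filled (A i j) ⊎ Filled (L i j) → Filled ((negate A ∪ L) i j)
negate-∪-support⁺ A L i j (inj₁ (x , A≡x)) =
  Filled-<∣>⁺ (map -_ (A i j)) (L i j) (inj₁ (- x , cong (map -_) A≡x))
negate-∪-support⁺ A L i j (inj₂ filled) = Filled-<∣>⁺ (map -_ (A i j)) (L i j) (inj₂ filled)

-a+[a+b]≡b : ∀ a b → - (+ a) ℤ.+ + (a + b) ≡ + b
-a+[a+b]≡b a b = trans (cong (λ s → - (+ a) ℤ.+ s) (ℤ.pos-+ a b)) (cancel (+ a) (+ b))
  where
  cancel : ∀ p q → - p ℤ.+ (p ℤ.+ q) ≡ q
  cancel = ℤ-Solver.solve-∀

negate-∪-isHeffter : ∀ {n k c} {A L : Array n} →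
  IsHeffter n k A → SumsTo n A (+ (2 * n * k + 1)) → Disjoint A L →
  LineCounts n L c → SumsTo n L (+ (2 * n * k + 1 + (2 * n * (k + c) + 1))) →
  (∀ x → n * k < x → x ≤ n * (k + c) → ∃ λ i → ∃ λ j → L i j ≡ just (+ x)) →
  IsHeffter n (k + c) (negate A ∪ L) × SumsTo n (negate A ∪ L) (+ (2 * n * (k + c) + 1))
negate-∪-isHeffter {n} {k} {c} {A} {L} A-heffter A-sums A∩L=∅ L-counts L-sums L-covers =
  record
    { rowCnt = proj₁ counts
    ; colCnt = proj₂ counts
    ; rowMod = proj₁ (SumsTo⇒divisible {M = B} sums)
    ; colMod = proj₂ (SumsTo⇒divisible {M = B} sums)
    ; cover  = covers
    } ,
  sums
  where
  open IsHeffter A-heffter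
  B = negate A ∪ L

  -A∩L=∅ : Disjoint (negate A) L
  -A∩L=∅ i j = A∩L=∅ i j ∘ Filled-map⁻ -_ (A i j)

  counts : LineCounts n B (k + c)
  counts = LineCounts-∪ -A∩L=∅ (LineCounts-negate {M = A} (rowCnt , colCnt)) L-counts

  sums : SumsTo n B (+ (2 * n * (k + c) + 1))
  sums = subst (SumsTo n B) (-a+[a+b]≡b (2 * n * k + 1) (2 * n * (k + c) + 1))
               (SumsTo-∪ -A∩L=∅ (SumsTo-negate {M = A} A-sums) L-sums)

  B-from-A : ∀ {i j y} → A i j ≡ just y → B i j ≡ just (- y)
  B-from-A eq rewrite eq = refl

  B-from-L : ∀ i j {y} → L i j ≡ just y → B i j ≡ just y
  B-from-L i j eq with A i j in eqA
  ... | nothing = eq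
  ... | just z  with () ← trans (sym eq) (A∩L=∅ i j (z , eqA))

  covers : ∀ x → 1 ≤ x → x ≤ n * (k + c) →
           ∃ λ i → ∃ λ j → (B i j ≡ just (+ x)) ⊎ (B i j ≡ just (- (+ x)))
  covers x 1≤x x≤n[k+c] with x ℕ.≤? n * k
  ... | yes x≤nk with cover x 1≤x x≤nk
  ...   | i , j , inj₁ eq = i , j , inj₂ (B-from-A eq)
  ...   | i , j , inj₂ eq = i , j , inj₁ (trans (B-from-A eq) (cong just (ℤ.neg-involutive (+ x))))
  covers x 1≤x x≤n[k+c] | no x≰nk with L-covers x (ℕ.≰⇒> x≰nk) x≤n[k+c]
  ... | i , j , eq = i , j , inj₁ (B-from-L i j eq)

-- The cyclic order on Fin n

module _ {n : ℕ} .{{_ : NonZero n}} where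

  rotate : ℕ → Fin n → Fin n
  rotate c t = (c + toℕ t) mod n

  toℕ-rotate : ∀ c t → toℕ (rotate c t) ≡ (c + toℕ t) % n
  toℕ-rotate c t = toℕ-fromℕ< (m%n<n (c + toℕ t) n)

  [m+n%d]%d≡[m+n]%d : ∀ a b → (a + b % n) % n ≡ (a + b) % n
  [m+n%d]%d≡[m+n]%d a b = begin
    (a + b % n) % n          ≡⟨ %-distribˡ-+ a (b % n) n ⟩
    (a % n + b % n % n) % n  ≡⟨ cong (λ z → (a % n + z) % n) (m%n%n≡m%n b n) ⟩
    (a % n + b % n) % n      ≡⟨ %-distribˡ-+ a b n ⟨
    (a + b) % n              ∎
    where open ≡-Reasoning

  rotate-∘ : ∀ c c' t → rotate c (rotate c' t) ≡ rotate (c + c') t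
  rotate-∘ c c' t = toℕ-injective (begin
    toℕ (rotate c (rotate c' t))  ≡⟨ toℕ-rotate c (rotate c' t) ⟩
    (c + toℕ (rotate c' t)) % n   ≡⟨ cong (λ z → (c + z) % n) (toℕ-rotate c' t) ⟩
    (c + (c' + toℕ t) % n) % n    ≡⟨ [m+n%d]%d≡[m+n]%d c (c' + toℕ t) ⟩
    (c + (c' + toℕ t)) % n        ≡⟨ cong (_% n) (ℕ.+-assoc c c' (toℕ t)) ⟨
    (c + c' + toℕ t) % n          ≡⟨ toℕ-rotate (c + c') t ⟨
    toℕ (rotate (c + c') t)       ∎)
    where open ≡-Reasoning

  rotate-by-n : ∀ t → rotate n t ≡ t
  rotate-by-n t = toℕ-injective (begin
    toℕ (rotate n t)  ≡⟨ toℕ-rotate n t ⟩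
    (n + toℕ t) % n   ≡⟨ cong (_% n) (ℕ.+-comm n (toℕ t)) ⟩
    (toℕ t + n) % n   ≡⟨ [m+n]%n≡m%n (toℕ t) n ⟩
    toℕ t % n         ≡⟨ m<n⇒m%n≡m (toℕ<n t) ⟩
    toℕ t             ∎)
    where open ≡-Reasoning

  rotate-inverse : ∀ {c c'} → c + c' ≡ n → ∀ t → rotate c (rotate c' t) ≡ t
  rotate-inverse c+c'≡n t = trans (rotate-∘ _ _ t) (trans (cong (λ z → rotate z t) c+c'≡n) (rotate-by-n t))

  rotate-comm : ∀ c c' t → rotate c (rotate c' t) ≡ rotate c' (rotate c t)
  rotate-comm c c' t =
    trans (rotate-∘ c c' t) (trans (cong (λ z → rotate z t) (ℕ.+-comm c c')) (sym (rotate-∘ c' c t)))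

  next prev : Fin n → Fin n
  next = rotate 1
  prev = rotate (n ∸ 1)

  next-prev : ∀ s → next (prev s) ≡ s
  next-prev = rotate-inverse (ℕ.m+[n∸m]≡n (ℕ.>-nonZero⁻¹ n))

  prev-next : ∀ t → prev (next t) ≡ t
  prev-next = rotate-inverse (ℕ.m∸n+n≡m (ℕ.>-nonZero⁻¹ n))

  cycNext⇒≡next : ∀ {t t'} → CycNext t t' → t' ≡ next t
  cycNext⇒≡next {t} {t'} (inj₁ t'≡1+t) = toℕ-injective (begin
    toℕ t'           ≡⟨ t'≡1+t ⟩
    suc (toℕ t)      ≡⟨ m<n⇒m%n≡m (subst (_< n) t'≡1+t (toℕ<n t')) ⟨
    suc (toℕ t) % n  ≡⟨ toℕ-rotate 1 t ⟨
    toℕ (next t)     ∎)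
    where open ≡-Reasoning
  cycNext⇒≡next {t} {t'} (inj₂ (1+t≡n , t'≡0)) = toℕ-injective (begin
    toℕ t'           ≡⟨ t'≡0 ⟩
    0                ≡⟨ n%n≡0 n ⟨
    n % n            ≡⟨ cong (_% n) 1+t≡n ⟨
    suc (toℕ t) % n  ≡⟨ toℕ-rotate 1 t ⟨
    toℕ (next t)     ∎)
    where open ≡-Reasoning

  cycNext-next : ∀ t → CycNext t (next t)
  cycNext-next t with ℕ.m≤n⇒m<n∨m≡n (toℕ<n t)
  ... | inj₁ 1+t<n = inj₁ (trans (toℕ-rotate 1 t) (m<n⇒m%n≡m 1+t<n))
  ... | inj₂ 1+t≡n = inj₂ (1+t≡n , trans (toℕ-rotate 1 t) (trans (cong (_% n) 1+t≡n) (n%n≡0 n)))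

  cycNext-prev : ∀ r → CycNext (prev r) r
  cycNext-prev r = subst (CycNext (prev r)) (next-prev r) (cycNext-next (prev r))

  next-irrefl : 2 ≤ n → ∀ t → next t ≢ t
  next-irrefl 2≤n t eq with subst (CycNext t) eq (cycNext-next t)
  ... | inj₁ t≡1+t         = ℕ.1+n≢n (sym t≡1+t)
  ... | inj₂ (1+t≡n , t≡0) = ℕ.<⇒≢ 2≤n (trans (cong suc (sym t≡0)) 1+t≡n)

opposite-complement : ∀ {n} (t : Fin n) → suc (toℕ t + toℕ (opposite t)) ≡ n
opposite-complement t = trans (cong (λ x → suc (toℕ t) + x) (opposite-prop t)) (ℕ.m+[n∸m]≡n (toℕ<n t))

opposite-last : ∀ {n} (t : Fin n) → suc (toℕ t) ≡ n → toℕ (opposite t) ≡ 0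
opposite-last {n} t 1+t≡n = trans (opposite-prop t) (trans (cong (n ∸_) 1+t≡n) (ℕ.n∸n≡0 n))

opposite-first : ∀ {n} (t : Fin n) → toℕ t ≡ 0 → suc (toℕ (opposite t)) ≡ n
opposite-first t t≡0 = subst (λ x → suc (x + toℕ (opposite t)) ≡ _) t≡0 (opposite-complement t)

-- Labelling a Hamilton cycle

injective⇒surjective : ∀ {n} {f : Fin n → Fin n} → Injective _≡_ _≡_ f → ∀ i → ∃ λ t → f t ≡ i
injective⇒surjective {zero}  f-inj ()
injective⇒surjective {suc n} {f} f-inj i with any? (λ t → f t ≟ i)
... | yes hit = hit
... | no miss = ⊥-elim (ℕ.1+n≰n (injective⇒≤ f-avoiding-i-injective))
  where
  f-avoiding-i : Fin (suc n) → Fin n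
  f-avoiding-i t = punchOut (λ eq → miss (t , sym eq))
  f-avoiding-i-injective : Injective _≡_ _≡_ f-avoiding-i
  f-avoiding-i-injective {t} {t'} eq =
    f-inj (punchOut-injective (λ eq → miss (t , sym eq)) (λ eq → miss (t' , sym eq)) eq)

record HamiltonEnumeration (n : ℕ) (H : CellSet n) : Set where
  field
    nontrivial  : 2 ≤ n
    σ τ         : Fin n → Fin n
    σ-injective : Injective _≡_ _≡_ σ
    τ-injective : Injective _≡_ _≡_ τ
    edge        : ∀ i j → H i j ≡ true →
                  ∃ λ t → (i ≡ σ t × j ≡ τ t) ⊎ (∃ λ t' → CycNext t t' × i ≡ σ t' × j ≡ τ t)
    diagonal    : ∀ t → H (σ t) (τ t) ≡ true
    subdiagonal : ∀ t t' → CycNext t t' → H (σ t') (τ t) ≡ true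

  σ⁻¹ τ⁻¹ : Fin n → Fin n
  σ⁻¹ = proj₁ ∘ injective⇒surjective σ-injective
  τ⁻¹ = proj₁ ∘ injective⇒surjective τ-injective

  σ-σ⁻¹ : ∀ i → σ (σ⁻¹ i) ≡ i
  σ-σ⁻¹ = proj₂ ∘ injective⇒surjective σ-injective

  τ-τ⁻¹ : ∀ j → τ (τ⁻¹ j) ≡ j
  τ-τ⁻¹ = proj₂ ∘ injective⇒surjective τ-injective

  σ⁻¹-σ : ∀ t → σ⁻¹ (σ t) ≡ t
  σ⁻¹-σ t = σ-injective (σ-σ⁻¹ (σ t))

  τ⁻¹-τ : ∀ t → τ⁻¹ (τ t) ≡ t
  τ⁻¹-τ t = τ-injective (τ-τ⁻¹ (τ t))

hamiltonEnumeration : ∀ {n} {H : CellSet n} → IsHamiltonCycle n H → HamiltonEnumeration n H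
hamiltonEnumeration (2≤n , σ , τ , σ-inj , τ-inj , edge , diagonal , subdiagonal) = record
  { nontrivial = 2≤n ; σ = σ ; τ = τ ; σ-injective = σ-inj ; τ-injective = τ-inj
  ; edge = edge ; diagonal = diagonal ; subdiagonal = subdiagonal }

module CycleLabelling {n} .{{_ : NonZero n}} {H : CellSet n} (C : HamiltonEnumeration n H)
                      (α β : Fin n → ℕ) where
  open HamiltonEnumeration C

  labelAt : Fin n → Fin n → Maybe ℤ
  labelAt s t with s ≟ t | s ≟ next t
  ... | yes _ | _     = just (+ α t)
  ... | no  _ | yes _ = just (+ β t)
  ... | no  _ | no  _ = nothing

  label : Array n
  label i j = labelAt (σ⁻¹ i) (τ⁻¹ j)

  labelAt-diagonal : ∀ t → labelAt t t ≡ just (+ α t)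
  labelAt-diagonal t with t ≟ t | t ≟ next t
  ... | yes _  | _ = refl
  ... | no t≢t | _ = ⊥-elim (t≢t refl)

  labelAt-subdiagonal : ∀ t → labelAt (next t) t ≡ just (+ β t)
  labelAt-subdiagonal t with next t ≟ t | next t ≟ next t
  ... | yes eq | _     = ⊥-elim (next-irrefl nontrivial t eq)
  ... | no  _  | yes _ = refl
  ... | no  _  | no ne = ⊥-elim (ne refl)

  labelAt-empty : ∀ {s t} → s ≢ t → s ≢ next t → labelAt s t ≡ nothing
  labelAt-empty {s} {t} s≢t s≢next with s ≟ t | s ≟ next t
  ... | yes eq | _      = ⊥-elim (s≢t eq)
  ... | no  _  | yes eq = ⊥-elim (s≢next eq)
  ... | no  _  | no  _  = refl

  labelAt-filled : ∀ s t → Filled (labelAt s t) → s ≡ t ⊎ s ≡ next t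
  labelAt-filled s t filled with s ≟ t | s ≟ next t | filled
  ... | yes eq | _      | _ = inj₁ eq
  ... | no  _  | yes eq | _ = inj₂ eq
  ... | no  _  | no  _  | _ , ()

  label-σ-τ : ∀ s t → label (σ s) (τ t) ≡ labelAt s t
  label-σ-τ s t = cong₂ labelAt (σ⁻¹-σ s) (τ⁻¹-τ t)

  label-diagonal : ∀ t → label (σ t) (τ t) ≡ just (+ α t)
  label-diagonal t = trans (label-σ-τ t t) (labelAt-diagonal t)

  label-subdiagonal : ∀ t → label (σ (next t)) (τ t) ≡ just (+ β t)
  label-subdiagonal t = trans (label-σ-τ (next t) t) (labelAt-subdiagonal t)

  rowSum-label : ∀ i → rowSum label i ≡ + (α (σ⁻¹ i) + β (prev (σ⁻¹ i))) × rowCount label i ≡ 2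
  rowSum-label i = trans (proj₁ two-cells) (sym (ℤ.pos-+ (α s) (β (prev s)))) , proj₂ two-cells
    where
    s = σ⁻¹ i
    cell : ∀ t → label i (τ t) ≡ labelAt s t
    cell t = cong (labelAt s) (τ⁻¹-τ t)
    τs≢τ[prev] : τ s ≢ τ (prev s)
    τs≢τ[prev] eq = next-irrefl nontrivial (prev s) (trans (next-prev s) (τ-injective eq))
    prev-cell : labelAt s (prev s) ≡ just (+ β (prev s))
    prev-cell = trans (cong (λ r → labelAt r (prev s)) (sym (next-prev s))) (labelAt-subdiagonal (prev s))
    elsewhere : ∀ j → j ≢ τ s → j ≢ τ (prev s) → label i j ≡ nothing
    elsewhere j j≢τs j≢τ[prev] = labelAt-empty
      (λ s≡t    → j≢τs (trans (sym (τ-τ⁻¹ j)) (cong τ (sym s≡t))))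
      (λ s≡next → j≢τ[prev] (trans (sym (τ-τ⁻¹ j))
                                    (cong τ (trans (sym (prev-next _)) (cong prev (sym s≡next))))))
    two-cells = ∑-two-cells (label i) τs≢τ[prev] (trans (cell s) (labelAt-diagonal s))
                            (trans (cell (prev s)) prev-cell) elsewhere

  colSum-label : ∀ j → colSum label j ≡ + (α (τ⁻¹ j) + β (τ⁻¹ j)) × colCount label j ≡ 2
  colSum-label j = trans (proj₁ two-cells) (sym (ℤ.pos-+ (α t) (β t))) , proj₂ two-cells
    where
    t = τ⁻¹ j
    cell : ∀ s → label (σ s) j ≡ labelAt s t
    cell s = cong (λ r → labelAt r t) (σ⁻¹-σ s)
    σt≢σ[next] : σ t ≢ σ (next t)
    σt≢σ[next] eq = next-irrefl nontrivial t (sym (σ-injective eq))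
    elsewhere : ∀ i → i ≢ σ t → i ≢ σ (next t) → label i j ≡ nothing
    elsewhere i i≢σt i≢σ[next] = labelAt-empty
      (λ s≡t    → i≢σt (trans (sym (σ-σ⁻¹ i)) (cong σ s≡t)))
      (λ s≡next → i≢σ[next] (trans (sym (σ-σ⁻¹ i)) (cong σ s≡next)))
    two-cells = ∑-two-cells (λ i → label i j) σt≢σ[next] (trans (cell t) (labelAt-diagonal t))
                            (trans (cell (next t)) (labelAt-subdiagonal t)) elsewhere

  label-filled⇒H : ∀ i j → Filled (label i j) → H i j ≡ true
  label-filled⇒H i j filled = subst₂ (λ a b → H a b ≡ true) (σ-σ⁻¹ i) (τ-τ⁻¹ j)
                                     (on-cycle (labelAt-filled (σ⁻¹ i) (τ⁻¹ j) filled))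
    where
    on-cycle : ∀ {s t} → s ≡ t ⊎ s ≡ next t → H (σ s) (τ t) ≡ true
    on-cycle (inj₁ refl) = diagonal _
    on-cycle (inj₂ refl) = subdiagonal _ _ (cycNext-next _)

  H⇒label-filled : ∀ i j → H i j ≡ true → Filled (label i j)
  H⇒label-filled i j h with edge i j h
  ... | t , inj₁ (refl , refl)             = _ , label-diagonal t
  ... | t , inj₂ (t' , t→t' , refl , refl) =
    _ , trans (cong (λ s → label (σ s) (τ t)) (cycNext⇒≡next t→t')) (label-subdiagonal t)

module RelativePosition {n} .{{_ : NonZero n}} {H : CellSet n} (C : HamiltonEnumeration n H) (i₀ : Fin n) where
  open HamiltonEnumeration C

  u≤n : toℕ (σ⁻¹ i₀) ≤ n
  u≤n = ℕ.<⇒≤ (toℕ<n (σ⁻¹ i₀))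

  ρ ρ⁻¹ : Fin n → Fin n
  ρ   = rotate (n ∸ toℕ (σ⁻¹ i₀))
  ρ⁻¹ = rotate (toℕ (σ⁻¹ i₀))

  ρ-ρ⁻¹ : ∀ r → ρ (ρ⁻¹ r) ≡ r
  ρ-ρ⁻¹ = rotate-inverse (ℕ.m∸n+n≡m u≤n)

  ρ⁻¹-ρ : ∀ s → ρ⁻¹ (ρ s) ≡ s
  ρ⁻¹-ρ = rotate-inverse (ℕ.m+[n∸m]≡n u≤n)

  ρ-prev : ∀ s → ρ (prev s) ≡ prev (ρ s)
  ρ-prev = rotate-comm _ _

  ρ-start : toℕ (ρ (σ⁻¹ i₀)) ≡ 0
  ρ-start = begin
    toℕ (ρ (σ⁻¹ i₀))                       ≡⟨ toℕ-rotate _ (σ⁻¹ i₀) ⟩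
    (n ∸ toℕ (σ⁻¹ i₀) + toℕ (σ⁻¹ i₀)) % n  ≡⟨ cong (_% n) (ℕ.m∸n+n≡m u≤n) ⟩
    n % n                                  ≡⟨ n%n≡0 n ⟩
    0                                      ∎
    where open ≡-Reasoning

  ρ≡0⇒start : ∀ i → toℕ (ρ (σ⁻¹ i)) ≡ 0 → i ≡ i₀
  ρ≡0⇒start i ρ≡0 = begin
    i                     ≡⟨ σ-σ⁻¹ i ⟨
    σ (σ⁻¹ i)             ≡⟨ cong σ (ρ⁻¹-ρ (σ⁻¹ i)) ⟨
    σ (ρ⁻¹ (ρ (σ⁻¹ i)))   ≡⟨ cong (σ ∘ ρ⁻¹) (toℕ-injective (trans ρ≡0 (sym ρ-start))) ⟩
    σ (ρ⁻¹ (ρ (σ⁻¹ i₀)))  ≡⟨ cong σ (ρ⁻¹-ρ (σ⁻¹ i₀)) ⟩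
    σ (σ⁻¹ i₀)            ≡⟨ σ-σ⁻¹ i₀ ⟩
    i₀                    ∎
    where open ≡-Reasoning

-- The labelling of two disjoint Hamilton cycles

-- The factors m * 0, …, m * 3 are kept so that the left-hand sides are the label sums verbatim.
module LabelArithmetic (N : ℕ) where

  row₁-step : ∀ {m} x y y' → x ≡ suc y → suc (y + y') ≡ m →
              N + m * 0 + suc x + (N + m * 2 + suc y') ≡ 2 * N + 3 * m + 2
  row₁-step _ y y' refl refl = solve (N ∷ y ∷ y' ∷ [])

  row₁-wrap : ∀ m → N + m * 0 + 1 + (N + m * 2 + 1) ≡ 2 * N + 2 * m + 2
  row₁-wrap m = solve (N ∷ m ∷ [])

  row₂-step : ∀ {m} x x' y → x ≡ suc y → suc (x + x') ≡ m →
              N + m * 1 + suc x' + (N + m * 3 + suc y) ≡ 2 * N + 5 * m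
  row₂-step _ x' y refl refl = solve (N ∷ x' ∷ y ∷ [])

  row₂-wrap : ∀ m → N + m * 1 + m + (N + m * 3 + m) ≡ 2 * N + 6 * m
  row₂-wrap m = solve (N ∷ m ∷ [])

  column₁ : ∀ {m} t t' → suc (t + t') ≡ m → N + m * 0 + suc t + (N + m * 2 + suc t') ≡ 2 * N + 3 * m + 1
  column₁ t t' refl = solve (N ∷ t ∷ t' ∷ [])

  column₂ : ∀ {m} t t' → suc (t + t') ≡ m → N + m * 1 + suc t' + (N + m * 3 + suc t) ≡ 2 * N + 5 * m + 1
  column₂ t t' refl = solve (N ∷ t ∷ t' ∷ [])

  1+N+[a+b]≡N+a+[1+b] : ∀ a b → suc N + (a + b) ≡ N + a + suc b
  1+N+[a+b]≡N+a+[1+b] a b = solve (N ∷ a ∷ b ∷ [])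

rows-total-step : ∀ n k → 2 * (n * k) + 3 * n + 2 + (2 * (n * k) + 5 * n) ≡
                          2 * n * k + 1 + (2 * n * (k + 4) + 1)
rows-total-step = solve-∀

rows-total-wrap : ∀ n k → 2 * (n * k) + 2 * n + 2 + (2 * (n * k) + 6 * n) ≡
                          2 * n * k + 1 + (2 * n * (k + 4) + 1)
rows-total-wrap = solve-∀

columns-total : ∀ n k → 2 * (n * k) + 3 * n + 1 + (2 * (n * k) + 5 * n + 1) ≡
                        2 * n * k + 1 + (2 * n * (k + 4) + 1)
columns-total = solve-∀

n*[k+4]≡n*k+4*n : ∀ n k → n * (k + 4) ≡ n * k + 4 * n
n*[k+4]≡n*k+4*n = solve-∀

module TwoCycleLabelling {n} .{{_ : NonZero n}} {H₁ H₂ : CellSet n}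
  (C₁ : HamiltonEnumeration n H₁) (C₂ : HamiltonEnumeration n H₂)
  (H₁∩H₂=∅ : ∀ i j → H₁ i j ≡ true → H₂ i j ≡ false) (k : ℕ) (i₀ : Fin n) where

  N lineTotal : ℕ
  N = n * k
  lineTotal = 2 * n * k + 1 + (2 * n * (k + 4) + 1)

  value : Fin 4 → Fin n → ℕ
  value q t = N + n * toℕ q + suc (toℕ t)

  a₁ a₂ b₁ b₂ : Fin n → ℕ
  a₁ r = value 0F r
  a₂ r = value 1F (opposite r)
  b₁ r = value 2F (opposite r)
  b₂ r = value 3F r

  private
    module C₁ = HamiltonEnumeration C₁
    module C₂ = HamiltonEnumeration C₂
    module P₁ = RelativePosition C₁ i₀
    module P₂ = RelativePosition C₂ i₀
    module L₁ = CycleLabelling C₁ (a₁ ∘ P₁.ρ) (b₁ ∘ P₁.ρ)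
    module L₂ = CycleLabelling C₂ (a₂ ∘ P₂.ρ) (b₂ ∘ P₂.ρ)
    open LabelArithmetic N

  L : Array n
  L = L₁.label ∪ L₂.label

  row-total : ∀ {q r q' r'} → CycNext q r → CycNext q' r' →
              (toℕ r ≡ 0 → toℕ r' ≡ 0) → (toℕ r' ≡ 0 → toℕ r ≡ 0) →
              a₁ r + b₁ q + (a₂ r' + b₂ q') ≡ lineTotal
  row-total {q} {r} {q'} {r'} (inj₁ r≡1+q) (inj₁ r'≡1+q') _ _ = begin
    a₁ r + b₁ q + (a₂ r' + b₂ q')
      ≡⟨ cong₂ _+_ (row₁-step (toℕ r) (toℕ q) (toℕ (opposite q)) r≡1+q (opposite-complement q))
                   (row₂-step (toℕ r') (toℕ (opposite r')) (toℕ q') r'≡1+q' (opposite-complement r')) ⟩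
    2 * N + 3 * n + 2 + (2 * N + 5 * n)
      ≡⟨ rows-total-step n k ⟩
    lineTotal ∎
    where open ≡-Reasoning
  row-total {q} {r} {q'} {r'} (inj₂ (1+q≡n , r≡0)) (inj₂ (1+q'≡n , r'≡0)) _ _ = begin
    a₁ r + b₁ q + (a₂ r' + b₂ q')
      ≡⟨ cong₂ _+_ (cong₂ (λ x y → N + n * 0 + suc x + (N + n * 2 + suc y)) r≡0 (opposite-last q 1+q≡n))
                   (cong₂ (λ x y → N + n * 1 + x + (N + n * 3 + y)) (opposite-first r' r'≡0) 1+q'≡n) ⟩
    N + n * 0 + 1 + (N + n * 2 + 1) + (N + n * 1 + n + (N + n * 3 + n))
      ≡⟨ cong₂ _+_ (row₁-wrap n) (row₂-wrap n) ⟩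
    2 * N + 2 * n + 2 + (2 * N + 6 * n)
      ≡⟨ rows-total-wrap n k ⟩
    lineTotal ∎
    where open ≡-Reasoning
  row-total (inj₁ r≡1+q) (inj₂ (_ , r'≡0)) _ r'≡0⇒r≡0 =
    ⊥-elim (ℕ.0≢1+n (trans (sym (r'≡0⇒r≡0 r'≡0)) r≡1+q))
  row-total (inj₂ (_ , r≡0)) (inj₁ r'≡1+q') r≡0⇒r'≡0 _ =
    ⊥-elim (ℕ.0≢1+n (trans (sym (r≡0⇒r'≡0 r≡0)) r'≡1+q'))

  column-total : ∀ t t' → a₁ t + b₁ t + (a₂ t' + b₂ t') ≡ lineTotal
  column-total t t' = trans
    (cong₂ _+_ (column₁ (toℕ t) (toℕ (opposite t)) (opposite-complement t))
               (column₂ (toℕ t') (toℕ (opposite t')) (opposite-complement t')))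
    (columns-total n k)

  label₂-empty : ∀ i j → H₂ i j ≡ false → L₂.label i j ≡ nothing
  label₂-empty i j H₂≡false with L₂.label i j in eq
  ... | nothing = refl
  ... | just v  with () ← trans (sym (L₂.label-filled⇒H i j (v , eq))) H₂≡false

  L₁∩L₂=∅ : Disjoint L₁.label L₂.label
  L₁∩L₂=∅ i j filled = label₂-empty i j (H₁∩H₂=∅ i j (L₁.label-filled⇒H i j filled))

  L-filled⇒H : ∀ i j → Filled (L i j) → H₁ i j ≡ true ⊎ H₂ i j ≡ true
  L-filled⇒H i j =
    Sum.map (L₁.label-filled⇒H i j) (L₂.label-filled⇒H i j) ∘ Filled-<∣>⁻ (L₁.label i j) (L₂.label i j)

  H⇒L-filled : ∀ i j → H₁ i j ≡ true ⊎ H₂ i j ≡ true → Filled (L i j)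
  H⇒L-filled i j =
    Filled-<∣>⁺ (L₁.label i j) (L₂.label i j) ∘ Sum.map (L₁.H⇒label-filled i j) (L₂.H⇒label-filled i j)

  avoiding-H⇒Disjoint : ∀ {A : Array n} →
    (∀ i j → H₁ i j ≡ true → A i j ≡ nothing) → (∀ i j → H₂ i j ≡ true → A i j ≡ nothing) → Disjoint A L
  avoiding-H⇒Disjoint H₁∩A=∅ H₂∩A=∅ i j (x , A≡x) with L i j in eq
  ... | nothing = refl
  ... | just v  with () ← trans (sym A≡x) ([ H₁∩A=∅ i j , H₂∩A=∅ i j ]′ (L-filled⇒H i j (v , eq)))

  L-counts : LineCounts n L 4
  L-counts = LineCounts-∪ L₁∩L₂=∅ (proj₂ ∘ L₁.rowSum-label , proj₂ ∘ L₁.colSum-label)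
                                   (proj₂ ∘ L₂.rowSum-label , proj₂ ∘ L₂.colSum-label)

  L-sums : SumsTo n L (+ lineTotal)
  L-sums = rows , columns
    where
    rows : ∀ i → rowSum L i ≡ + lineTotal
    rows i = begin
      rowSum L i
        ≡⟨ rowSum-∪ L₁∩L₂=∅ i ⟩
      rowSum L₁.label i ℤ.+ rowSum L₂.label i
        ≡⟨ cong₂ ℤ._+_ (proj₁ (L₁.rowSum-label i)) (proj₁ (L₂.rowSum-label i)) ⟩
      + (a₁ r₁ + b₁ (P₁.ρ (prev s₁))) ℤ.+ + (a₂ r₂ + b₂ (P₂.ρ (prev s₂)))
        ≡⟨ ℤ.pos-+ (a₁ r₁ + b₁ (P₁.ρ (prev s₁))) _ ⟨
      + (a₁ r₁ + b₁ (P₁.ρ (prev s₁)) + (a₂ r₂ + b₂ (P₂.ρ (prev s₂))))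
        ≡⟨ cong₂ (λ q q' → + (a₁ r₁ + b₁ q + (a₂ r₂ + b₂ q'))) (P₁.ρ-prev s₁) (P₂.ρ-prev s₂) ⟩
      + (a₁ r₁ + b₁ (prev r₁) + (a₂ r₂ + b₂ (prev r₂)))
        ≡⟨ cong +_ (row-total (cycNext-prev r₁) (cycNext-prev r₂) r₁≡0⇒r₂≡0 r₂≡0⇒r₁≡0) ⟩
      + lineTotal ∎
      where
      open ≡-Reasoning
      s₁ = C₁.σ⁻¹ i
      s₂ = C₂.σ⁻¹ i
      r₁ = P₁.ρ s₁
      r₂ = P₂.ρ s₂
      r₁≡0⇒r₂≡0 : toℕ r₁ ≡ 0 → toℕ r₂ ≡ 0
      r₁≡0⇒r₂≡0 r₁≡0 = subst (λ x → toℕ (P₂.ρ (C₂.σ⁻¹ x)) ≡ 0) (sym (P₁.ρ≡0⇒start i r₁≡0)) P₂.ρ-start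
      r₂≡0⇒r₁≡0 : toℕ r₂ ≡ 0 → toℕ r₁ ≡ 0
      r₂≡0⇒r₁≡0 r₂≡0 = subst (λ x → toℕ (P₁.ρ (C₁.σ⁻¹ x)) ≡ 0) (sym (P₂.ρ≡0⇒start i r₂≡0)) P₁.ρ-start
    columns : ∀ j → colSum L j ≡ + lineTotal
    columns j = begin
      colSum L j
        ≡⟨ colSum-∪ L₁∩L₂=∅ j ⟩
      colSum L₁.label j ℤ.+ colSum L₂.label j
        ≡⟨ cong₂ ℤ._+_ (proj₁ (L₁.colSum-label j)) (proj₁ (L₂.colSum-label j)) ⟩
      + (a₁ t₁ + b₁ t₁) ℤ.+ + (a₂ t₂ + b₂ t₂)
        ≡⟨ ℤ.pos-+ (a₁ t₁ + b₁ t₁) _ ⟨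
      + (a₁ t₁ + b₁ t₁ + (a₂ t₂ + b₂ t₂))
        ≡⟨ cong +_ (column-total t₁ t₂) ⟩
      + lineTotal ∎
      where
      open ≡-Reasoning
      t₁ = P₁.ρ (C₁.τ⁻¹ j)
      t₂ = P₂.ρ (C₂.τ⁻¹ j)

  L-from₁ : ∀ {i j v} → L₁.label i j ≡ just v → L i j ≡ just v
  L-from₁ eq rewrite eq = refl

  L-from₂ : ∀ {i j v} → L₂.label i j ≡ just v → L i j ≡ just v
  L-from₂ {i} {j} eq with L₁.label i j in eq₁
  ... | nothing = eq
  ... | just w  with () ← trans (sym eq) (L₁∩L₂=∅ i j (w , eq₁))

  value-attained : ∀ q t → ∃ λ i → ∃ λ j → L i j ≡ just (+ value q t)
  value-attained 0F t =
    _ , _ , trans (L-from₁ (L₁.label-diagonal (P₁.ρ⁻¹ t))) (cong (just ∘ +_ ∘ a₁) (P₁.ρ-ρ⁻¹ t))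
  value-attained 1F t =
    _ , _ , trans (L-from₂ (L₂.label-diagonal (P₂.ρ⁻¹ (opposite t))))
                  (cong (just ∘ +_ ∘ value 1F) (trans (cong opposite (P₂.ρ-ρ⁻¹ _)) (opposite-involutive t)))
  value-attained 2F t =
    _ , _ , trans (L-from₁ (L₁.label-subdiagonal (P₁.ρ⁻¹ (opposite t))))
                  (cong (just ∘ +_ ∘ value 2F) (trans (cong opposite (P₁.ρ-ρ⁻¹ _)) (opposite-involutive t)))
  value-attained 3F t =
    _ , _ , trans (L-from₂ (L₂.label-subdiagonal (P₂.ρ⁻¹ t))) (cong (just ∘ +_ ∘ b₂) (P₂.ρ-ρ⁻¹ t))

  L-covers : ∀ x → n * k < x → x ≤ n * (k + 4) → ∃ λ i → ∃ λ j → L i j ≡ just (+ x)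
  L-covers x N<x x≤n[k+4] with ℕ.m≤n⇒∃[o]m+o≡n N<x
  ... | y , refl = subst (λ v → ∃ λ i → ∃ λ j → L i j ≡ just (+ v)) value≡x (value-attained q t)
    where
    y<4n : y < 4 * n
    y<4n = ℕ.+-cancelˡ-≤ N (suc y) (4 * n)
             (subst₂ _≤_ (sym (ℕ.+-suc N y)) (n*[k+4]≡n*k+4*n n k) x≤n[k+4])
    q = proj₁ (remQuot n (fromℕ< y<4n))
    t = proj₂ (remQuot n (fromℕ< y<4n))
    value≡x : value q t ≡ suc N + y
    value≡x = begin
      N + n * toℕ q + suc (toℕ t)  ≡⟨ 1+N+[a+b]≡N+a+[1+b] (n * toℕ q) (toℕ t) ⟨
      suc N + (n * toℕ q + toℕ t)  ≡⟨ cong (λ z → suc N + z) (toℕ-combine q t) ⟨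
      suc N + toℕ (combine q t)    ≡⟨ cong (λ i → suc N + toℕ i) (combine-remQuot n (fromℕ< y<4n)) ⟩
      suc N + toℕ (fromℕ< y<4n)    ≡⟨ cong (λ z → suc N + z) (toℕ-fromℕ< y<4n) ⟩
      suc N + y                    ∎
      where open ≡-Reasoning

theorem2p2 : (n k : ℕ) (A : Array n) →
    IsHeffter n k A →
    SumsTo n A (+ (2 * n * k + 1)) →
    (H₁ H₂ : CellSet n) →
    IsHamiltonCycle n H₁ →
    IsHamiltonCycle n H₂ →
    (∀ i j → H₁ i j ≡ true → H₂ i j ≡ false) →
    (∀ i j → H₁ i j ≡ true → A i j ≡ nothing) →
    (∀ i j → H₂ i j ≡ true → A i j ≡ nothing) →
    Σ (Array n) λ B →
      IsHeffter n (k + 4) B ×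
      SumsTo n B (+ (2 * n * (k + 4) + 1)) ×
      (∀ i j → Filled (B i j) → Filled (A i j) ⊎ (H₁ i j ≡ true ⊎ H₂ i j ≡ true)) ×
      (∀ i j → Filled (A i j) ⊎ (H₁ i j ≡ true ⊎ H₂ i j ≡ true) → Filled (B i j))
theorem2p2 zero    k A _ _ H₁ H₂ (() , _) _ _ _ _
theorem2p2 (suc m) k A A-heffter A-sums H₁ H₂ H₁-cycle H₂-cycle H₁∩H₂=∅ H₁∩A=∅ H₂∩A=∅ =
  negate A ∪ L , proj₁ B-is-Heffter , proj₂ B-is-Heffter ,
  (λ i j → Sum.map₂ (L-filled⇒H i j) ∘ negate-∪-support⁻ A L i j) ,
  (λ i j → negate-∪-support⁺ A L i j ∘ Sum.map₂ (H⇒L-filled i j))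
  where
  open TwoCycleLabelling (hamiltonEnumeration H₁-cycle) (hamiltonEnumeration H₂-cycle) H₁∩H₂=∅ k 0F
  B-is-Heffter =
    negate-∪-isHeffter A-heffter A-sums (avoiding-H⇒Disjoint H₁∩A=∅ H₂∩A=∅) L-counts L-sums L-covers
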